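{- Let $\mathbb{P}=(A,X,I)$ be a formal context and $R\subseteq A\times X$. 1. The following are equivalent: (i) $R^{(0)}[x]$ is Galois-stable for every $x\in X$; (ii) $R^{(0)}[Y]$ is Galois-stable for every $Y\subseteq X$; (iii) $R^{(1)}[B]=R^{(1)}[B^{\uparrow\downarrow}]$ for every $B\subseteq A$. 2. The following are equivalent: (i) $R^{(1)}[a]$ is Galois-stable for every $a\in A$; (ii) $R^{(1)}[B]$ is Galois-stable for every $B\subseteq A$; (iii) $R^{(0)}[Y]=R^{(0)}[Y^{\downarrow\uparrow}]$ for every $Y\subseteq X$.
   Context: A formal context is a triple $(A,X,I)$ with $A,X$ sets and $I\subseteq A\times X$. For $T\subseteq A\times X$, $B\subseteq A$, $Y\subseteq X$: $T^{(1)}[B]=\{x\in X\mid\forall b\in B\,(bTx)\}$, $T^{(0)}[Y]=\{a\in A\mid\forall y\in Y\,(aTy)\}$ (singletons written without braces). $B^{\uparrow}:=I^{(1)}[B]$, $Y^{\downarrow}:=I^{(0)}[Y]$. A set $B\subseteq A$ is Galois-stable if $B^{\uparrow\downarrow}=B$; a set $Y\subseteq X$ is Galois-stable if $Y^{\downarrow\uparrow}=Y$. -}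

module Defs where

open import Level using (Level)
open import Relation.Binary.PropositionalEquality using (_≡_)
open import Data.Product using (_×_)

Subset : ∀ {ℓ} → Set ℓ → Set _
Subset {ℓ} A = A → Set ℓ

_⊆_ : ∀ {ℓ} {A : Set ℓ} → Subset A → Subset A → Set ℓ
B ⊆ C = ∀ a → B a → C a

_≐_ : ∀ {ℓ} {A : Set ℓ} → Subset A → Subset A → Set ℓ
B ≐ C = (B ⊆ C) × (C ⊆ B)

⟦_⟧ : ∀ {ℓ} {A : Set ℓ} → A → Subset A
⟦ a ⟧ = λ b → b ≡ a

Rel : ∀ {ℓ} → Set ℓ → Set ℓ → Set _
Rel {ℓ} A X = A → X → Set ℓ

_⁽¹⁾[_] : ∀ {ℓ} {A X : Set ℓ} → Rel A X → Subset A → Subset X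
(T ⁽¹⁾[ B ]) x = ∀ b → B b → T b x

_⁽⁰⁾[_] : ∀ {ℓ} {A X : Set ℓ} → Rel A X → Subset X → Subset A
(T ⁽⁰⁾[ Y ]) a = ∀ y → Y y → T a y

record Context (ℓ : Level) : Set (Level.suc ℓ) where
  field
    Obj  : Set ℓ
    Attr : Set ℓ
    I    : Rel Obj Attr

module _ {ℓ} (P : Context ℓ) where
  open Context P

  _↑ : Subset Obj → Subset Attr
  B ↑ = I ⁽¹⁾[ B ]

  _↓ : Subset Attr → Subset Obj
  Y ↓ = I ⁽⁰⁾[ Y ]

  GaloisStableA : Subset Obj → Set ℓ
  GaloisStableA B = ((B ↑) ↓) ≐ B

  GaloisStableX : Subset Attr → Set ℓ
  GaloisStableX Y = ((Y ↓) ↑) ≐ Y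

-- Every set of the form R⁽⁰⁾[Y] is the intersection of the sets R⁽⁰⁾[⟦y⟧] with y ∈ Y, and
-- Galois closure is monotone, so stability of the "columns" R⁽⁰⁾[⟦x⟧] propagates to all
-- R⁽⁰⁾[Y]. Since R⁽⁰⁾ and R⁽¹⁾ form a Galois connection, B ⊆ R⁽⁰⁾[⟦x⟧] means x ∈ R⁽¹⁾[B],
-- which turns stability of the columns into invariance of R⁽¹⁾ under closure, and back.
-- Part 2 is part 1 for the transposed context and relation, whose ↑ and ↓ are
-- definitionally ↓ and ↑ of the original context.
module Submission where

open import Defs
open import Data.Product using (_×_; _,_; proj₁)
open import Function.Bundles using (_⇔_; mk⇔)
open import Relation.Binary.PropositionalEquality using (refl)

module _ {ℓ} {A X : Set ℓ} (T : Rel A X) where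

  ⁽¹⁾-antitone : ∀ {B C} → B ⊆ C → (T ⁽¹⁾[ C ]) ⊆ (T ⁽¹⁾[ B ])
  ⁽¹⁾-antitone B⊆C x xTC b b∈B = xTC b (B⊆C b b∈B)

  ⁽⁰⁾-antitone : ∀ {Y Z} → Y ⊆ Z → (T ⁽⁰⁾[ Z ]) ⊆ (T ⁽⁰⁾[ Y ])
  ⁽⁰⁾-antitone Y⊆Z a aTZ y y∈Y = aTZ y (Y⊆Z y y∈Y)

  ⊆⁽⁰⁾⇒⊆⁽¹⁾ : ∀ {B Y} → B ⊆ (T ⁽⁰⁾[ Y ]) → Y ⊆ (T ⁽¹⁾[ B ])
  ⊆⁽⁰⁾⇒⊆⁽¹⁾ B⊆TY y y∈Y b b∈B = B⊆TY b b∈B y y∈Y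

  ⊆⁽¹⁾⇒⊆⁽⁰⁾ : ∀ {B Y} → Y ⊆ (T ⁽¹⁾[ B ]) → B ⊆ (T ⁽⁰⁾[ Y ])
  ⊆⁽¹⁾⇒⊆⁽⁰⁾ Y⊆TB b b∈B y y∈Y = Y⊆TB y y∈Y b b∈B

  ⁽⁰⁾[⟦⟧]⇒ : ∀ {a y} → (T ⁽⁰⁾[ ⟦ y ⟧ ]) a → T a y
  ⁽⁰⁾[⟦⟧]⇒ {y = y} aTy = aTy y refl

module _ {ℓ} (P : Context ℓ) where
  open Context P

  _↑↓ : Subset Obj → Subset Obj
  B ↑↓ = _↓ P (_↑ P B)

  ⊆-↑↓ : ∀ B → B ⊆ (B ↑↓)
  ⊆-↑↓ B = ⊆⁽¹⁾⇒⊆⁽⁰⁾ I (λ x x∈B↑ → x∈B↑)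

  ↑↓-monotone : ∀ {B C} → B ⊆ C → (B ↑↓) ⊆ (C ↑↓)
  ↑↓-monotone B⊆C = ⁽⁰⁾-antitone I (⁽¹⁾-antitone I B⊆C)

  ↑↓⊆⇒GaloisStableA : ∀ {B} → (B ↑↓) ⊆ B → GaloisStableA P B
  ↑↓⊆⇒GaloisStableA {B} B↑↓⊆B = B↑↓⊆B , ⊆-↑↓ B

  ⊆-stable⇒↑↓⊆ : ∀ {B C} → GaloisStableA P C → B ⊆ C → (B ↑↓) ⊆ C
  ⊆-stable⇒↑↓⊆ (C↑↓⊆C , _) B⊆C a a∈B↑↓ = C↑↓⊆C a (↑↓-monotone B⊆C a a∈B↑↓)

  module _ (R : Rel Obj Attr) where

    stable-columns⇒stable-⁽⁰⁾ : (∀ x → GaloisStableA P (R ⁽⁰⁾[ ⟦ x ⟧ ])) →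
      ∀ Y → GaloisStableA P (R ⁽⁰⁾[ Y ])
    stable-columns⇒stable-⁽⁰⁾ stable Y = ↑↓⊆⇒GaloisStableA λ a a∈closure y y∈Y →
      ⁽⁰⁾[⟦⟧]⇒ R (⊆-stable⇒↑↓⊆ (stable y) (⁽⁰⁾-antitone R λ { _ refl → y∈Y }) a a∈closure)

    stable-columns⇒⁽¹⁾-↑↓-invariant : (∀ x → GaloisStableA P (R ⁽⁰⁾[ ⟦ x ⟧ ])) →
      ∀ B → (R ⁽¹⁾[ B ]) ≐ (R ⁽¹⁾[ B ↑↓ ])
    stable-columns⇒⁽¹⁾-↑↓-invariant stable B =
        (λ x x∈RB → ⊆⁽⁰⁾⇒⊆⁽¹⁾ R (⊆-stable⇒↑↓⊆ (stable x) (column x x∈RB)) x refl)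
      , ⁽¹⁾-antitone R (⊆-↑↓ B)
      where
      column : ∀ x → (R ⁽¹⁾[ B ]) x → B ⊆ (R ⁽⁰⁾[ ⟦ x ⟧ ])
      column x x∈RB = ⊆⁽¹⁾⇒⊆⁽⁰⁾ R λ { _ refl → x∈RB }

    ⁽¹⁾-↑↓-invariant⇒stable-⁽⁰⁾ : (∀ B → (R ⁽¹⁾[ B ]) ≐ (R ⁽¹⁾[ B ↑↓ ])) →
      ∀ Y → GaloisStableA P (R ⁽⁰⁾[ Y ])
    ⁽¹⁾-↑↓-invariant⇒stable-⁽⁰⁾ invariant Y =
      ↑↓⊆⇒GaloisStableA (⊆⁽¹⁾⇒⊆⁽⁰⁾ R Y⊆R⁽¹⁾[closure])
      where
      Y⊆R⁽¹⁾[closure] : Y ⊆ (R ⁽¹⁾[ (R ⁽⁰⁾[ Y ]) ↑↓ ])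
      Y⊆R⁽¹⁾[closure] y y∈Y =
        proj₁ (invariant (R ⁽⁰⁾[ Y ])) y (⊆⁽⁰⁾⇒⊆⁽¹⁾ R (λ _ a∈RY → a∈RY) y y∈Y)

    stability-equivalences :
      ((∀ x → GaloisStableA P (R ⁽⁰⁾[ ⟦ x ⟧ ])) ⇔ (∀ Y → GaloisStableA P (R ⁽⁰⁾[ Y ])))
      × ((∀ Y → GaloisStableA P (R ⁽⁰⁾[ Y ])) ⇔ (∀ B → (R ⁽¹⁾[ B ]) ≐ (R ⁽¹⁾[ B ↑↓ ])))
    stability-equivalences =
        mk⇔ stable-columns⇒stable-⁽⁰⁾ (λ stable x → stable ⟦ x ⟧)
      , mk⇔ (λ stable → stable-columns⇒⁽¹⁾-↑↓-invariant (λ x → stable ⟦ x ⟧))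
            ⁽¹⁾-↑↓-invariant⇒stable-⁽⁰⁾

transpose : ∀ {ℓ} → Context ℓ → Context ℓ
transpose P = record { Obj = Context.Attr P ; Attr = Context.Obj P ; I = λ x a → Context.I P a x }

lemma9 : ∀ {ℓ} (P : Context ℓ) (R : Rel (Context.Obj P) (Context.Attr P)) →
    ( ((∀ x → GaloisStableA P (R ⁽⁰⁾[ ⟦ x ⟧ ])) ⇔ (∀ Y → GaloisStableA P (R ⁽⁰⁾[ Y ])))
    × ((∀ Y → GaloisStableA P (R ⁽⁰⁾[ Y ])) ⇔ (∀ B → (R ⁽¹⁾[ B ]) ≐ (R ⁽¹⁾[ _↓ P (_↑ P B) ]))) )
    × ( ((∀ a → GaloisStableX P (R ⁽¹⁾[ ⟦ a ⟧ ])) ⇔ (∀ B → GaloisStableX P (R ⁽¹⁾[ B ])))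
    × ((∀ B → GaloisStableX P (R ⁽¹⁾[ B ])) ⇔ (∀ Y → (R ⁽⁰⁾[ Y ]) ≐ (R ⁽⁰⁾[ _↑ P (_↓ P Y) ]))) )
lemma9 P R = stability-equivalences P R , stability-equivalences (transpose P) (λ x a → R a x)
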